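{- Let $n$ be a positive integer and let $G$ be a graph obtained from the complete graph $K_{2n+1}$ by removing fewer than $n/2$ edges. Then $\chi_i^{c}(G)=2\Delta(G)+2=4n+2$.
   Context: An incidence of a graph $G$ is a pair $(v,e)$ where $v$ is a vertex and $e$ an edge incident with $v$. For a vertex $w$, let $I(w)$ be the set of all incidences $(u,e)$ such that $e$ is incident with $w$. Two incidences conflict if both lie in $I(w)$ for some vertex $w$. A conflict-free incidence $k$-coloring assigns colors from a $k$-element set to the incidences so that conflicting incidences get distinct colors; $\chi^{c}_i(G)$ is the least such $k$. $\Delta(G)$ denotes the maximum degree. -}

module Defs where

open import Data.Nat using (ℕ; zero; suc; _+_; _*_; _⊔_; _≤_; _<_)
open import Data.Bool using (Bool; true; false; if_then_else_)
open import Data.Fin using (Fin; toℕ)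
open import Data.List using (List; map; foldr; allFin)
open import Data.Nat.ListAction using (sum)
open import Data.Product using (_×_; _,_; ∃-syntax)
open import Data.Sum using (_⊎_)
open import Relation.Binary.PropositionalEquality using (_≡_; _≢_)
open import Relation.Nullary.Decidable using (⌊_⌋)
import Data.Nat as ℕ

record Graph (m : ℕ) : Set where
  field
    adj     : Fin m → Fin m → Bool
    adj-sym : ∀ u v → adj u v ≡ adj v u
    adj-irr : ∀ v → adj v v ≡ false
open Graph public

-- Number of edges of K_m missing from G: unordered pairs {i,j} (i < j) that
-- are not adjacent in G.
missing : ∀ {m} → Graph m → Fin m → Fin m → ℕ
missing G i j =
  if ⌊ toℕ i ℕ.<? toℕ j ⌋ then (if adj G i j then 0 else 1) else 0

removedEdges : ∀ {m} → Graph m → ℕ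
removedEdges {m} G = sum (map (λ i → sum (map (λ j → missing G i j) (allFin m))) (allFin m))

degree : ∀ {m} → Graph m → Fin m → ℕ
degree {m} G v = sum (map (λ w → if adj G v w then 1 else 0) (allFin m))

maxDegree : ∀ {m} → Graph m → ℕ
maxDegree {m} G = foldr _⊔_ 0 (map (degree G) (allFin m))

-- An incidence (v, e) with e = {v, w} is represented by the ordered pair (v , w)
-- together with a proof that v w is an edge.
Conflict : ∀ {m} → Fin m → Fin m → Fin m → Fin m → Set
Conflict v w v' w' = ∃[ z ] ((z ≡ v ⊎ z ≡ w) × (z ≡ v' ⊎ z ≡ w'))

ConflictFreeIncidenceColouring : ∀ {m} → Graph m → ℕ → Set
ConflictFreeIncidenceColouring {m} G k =
  (v w : Fin m) → adj G v w ≡ true → Fin k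

IsCFColouring : ∀ {m} (G : Graph m) (k : ℕ) → ConflictFreeIncidenceColouring G k → Set
IsCFColouring {m} G k c =
  ∀ (v w v' w' : Fin m) (p : adj G v w ≡ true) (p' : adj G v' w' ≡ true) →
    (v , w) ≢ (v' , w') → Conflict v w v' w' → c v w p ≢ c v' w' p'

CFColourable : ∀ {m} → Graph m → ℕ → Set
CFColourable G k = ∃[ c ] IsCFColouring G k c

IncidenceCFChromatic : ∀ {m} → Graph m → ℕ → Set
IncidenceCFChromatic G k = CFColourable G k × (∀ j → CFColourable G j → k ≤ j)

-- Write m = 2n + 1 and r for the number of removed edges. Counting ordered pairs of vertices gives
-- ∑ deg = m(m − 1) − 2r, and 2r < n makes this exceed m(2n) − n. Hence Δ = 2n, for otherwise
-- ∑ deg ≤ m(2n − 1). In a conflict-free incidence colouring the incidences of one colour meet each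
-- vertex at most once, so a colour class has at most ⌊m/2⌋ = n incidences, and 4n + 1 colours would
-- cover at most (4n + 1)n = m(2n) − n incidences. Conversely, colouring (v, w) by the pair
-- ([v < w], v + w mod m) is conflict-free with 2m = 4n + 2 colours: for fixed v the map w ↦ v + w
-- is injective mod m, and the first component separates (v, w) from (w, v).

module Submission where

open import Defs
import Data.Nat as ℕ
open import Data.Nat
  using (ℕ; zero; suc; _+_; _*_; _∸_; _⊔_; _≤_; _<_; z≤n; s≤s; z<s; NonZero; >-nonZero; _%_; ⌊_/2⌋)
open import Data.Nat.Properties hiding (_≟_)
open import Data.Nat.DivMod using (_mod_; m<n⇒m%n≡m; m≤n⇒[n∸m]%m≡n%m)
open import Data.Nat.Tactic.RingSolver using (solve-∀)
open import Data.Bool using (Bool; true; false; if_then_else_)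
open import Data.Fin using (Fin; toℕ; combine; remQuot) renaming (zero to fzero; suc to fsuc)
open import Data.Fin.Properties using (_≟_; remQuot-combine; toℕ-fromℕ<; toℕ-injective; toℕ<n)
import Data.Fin.Properties as Fin
open import Data.List using (map; foldr; allFin; tabulate)
open import Data.List.Properties using (map-tabulate)
import Data.Nat.ListAction as List
open import Algebra.Properties.CommutativeMonoid.Sum +-0-commutativeMonoid
  using (sum-syntax; ∑-distrib-+; ∑-comm; sum-cong-≗; sum-replicate-zero)
open import Data.Product using (_×_; _,_; proj₁; Σ)
open import Data.Product.Properties using (,-injective; ≡-dec)
open import Data.Sum using (_⊎_; inj₁; inj₂)
open import Data.Empty using (⊥; ⊥-elim)
open import Function using (id; _∘_)
open import Relation.Binary.PropositionalEquality
open import Relation.Binary.Definitions using (tri<; tri≈; tri>)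
open import Relation.Nullary using (¬_; does; yes; no; contradiction)
open import Relation.Nullary.Decidable using (decidable-stable)

indicator : Bool → ℕ
indicator b = if b then 1 else 0

sum-tabulate : ∀ {m} (f : Fin m → ℕ) → List.sum (tabulate f) ≡ ∑[ i < m ] f i
sum-tabulate {zero}  f = refl
sum-tabulate {suc m} f = cong (f fzero +_) (sum-tabulate (f ∘ fsuc))

sum-map-allFin : ∀ {m} (f : Fin m → ℕ) → List.sum (map f (allFin m)) ≡ ∑[ i < m ] f i
sum-map-allFin f = trans (cong List.sum (map-tabulate id f)) (sum-tabulate f)

∑-mono-≤ : ∀ {m} {f g : Fin m → ℕ} → (∀ i → f i ≤ g i) → ∑[ i < m ] f i ≤ ∑[ i < m ] g i
∑-mono-≤ {zero}  f≤g = z≤n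
∑-mono-≤ {suc m} f≤g = +-mono-≤ (f≤g fzero) (∑-mono-≤ (f≤g ∘ fsuc))

∑-const : ∀ m c → ∑[ i < m ] c ≡ m * c
∑-const zero    c = refl
∑-const (suc m) c = cong (c +_) (∑-const m c)

∑-δ : ∀ {m} (i : Fin m) → ∑[ j < m ] indicator (does (i ≟ j)) ≡ 1
∑-δ {suc m} fzero    = cong suc (sum-replicate-zero m)
∑-δ {suc m} (fsuc i) = ∑-δ i

∑-≤1 : ∀ {m} {f : Fin m → ℕ} → (∀ i → f i ≤ 1) →
       (∀ i j → 0 < f i → 0 < f j → i ≡ j) → ∑[ i < m ] f i ≤ 1
∑-≤1 {zero}          _   _     = z≤n
∑-≤1 {suc m} {f} f≤1 unique with f fzero in f0 | f≤1 fzero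
... | zero        | _ = ∑-≤1 (f≤1 ∘ fsuc) λ i j p q → Fin.suc-injective (unique (fsuc i) (fsuc j) p q)
... | suc zero    | _ = s≤s (≤-trans (∑-mono-≤ tail≤0) (≤-reflexive (sum-replicate-zero m)))
  where
  tail≤0 : ∀ i → f (fsuc i) ≤ 0
  tail≤0 i with f (fsuc i) in fi
  ... | zero  = z≤n
  ... | suc _ with unique fzero (fsuc i) (subst (0 <_) (sym f0) z<s) (subst (0 <_) (sym fi) z<s)
  ...   | ()
... | suc (suc _) | s≤s ()

∑∑-distrib-+ : ∀ {m n} (f g : Fin m → Fin n → ℕ) →
               ∑[ i < m ] ∑[ j < n ] (f i j + g i j) ≡
               ∑[ i < m ] ∑[ j < n ] f i j + ∑[ i < m ] ∑[ j < n ] g i j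
∑∑-distrib-+ {n = n} f g = trans (sum-cong-≗ (λ i → ∑-distrib-+ (f i) (g i)))
                                 (∑-distrib-+ (λ i → ∑[ j < n ] f i j) (λ i → ∑[ j < n ] g i j))

+-≤1 : ∀ {x y} → x ≤ 1 → y ≤ 1 → (0 < x → 0 < y → ⊥) → x + y ≤ 1
+-≤1 z≤n       y≤1       _    = y≤1
+-≤1 (s≤s z≤n) z≤n       _    = ≤-refl
+-≤1 (s≤s z≤n) (s≤s z≤n) both = ⊥-elim (both z<s z<s)

+-positive : ∀ x {y} → 0 < x + y → 0 < x ⊎ 0 < y
+-positive zero    pos = inj₂ pos
+-positive (suc _) _   = inj₁ z<s

≤-maximum : ∀ {m} (f : Fin m → ℕ) i → f i ≤ foldr _⊔_ 0 (map f (allFin m))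
≤-maximum f i = subst (f i ≤_) (cong (foldr _⊔_ 0) (sym (map-tabulate id f))) (≤-max-tabulate f i)
  where
  ≤-max-tabulate : ∀ {m} (f : Fin m → ℕ) i → f i ≤ foldr _⊔_ 0 (tabulate f)
  ≤-max-tabulate f fzero    = m≤m⊔n _ _
  ≤-max-tabulate f (fsuc i) = ≤-trans (≤-max-tabulate (f ∘ fsuc) i) (m≤n⊔m _ _)

maximum-≤ : ∀ {m b} (f : Fin m → ℕ) → (∀ i → f i ≤ b) → foldr _⊔_ 0 (map f (allFin m)) ≤ b
maximum-≤ f f≤b = subst (_≤ _) (cong (foldr _⊔_ 0) (sym (map-tabulate id f))) (max-tabulate-≤ f f≤b)
  where
  max-tabulate-≤ : ∀ {m b} (f : Fin m → ℕ) → (∀ i → f i ≤ b) → foldr _⊔_ 0 (tabulate f) ≤ b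
  max-tabulate-≤ {zero}  f f≤b = z≤n
  max-tabulate-≤ {suc m} f f≤b = ⊔-lub (f≤b fzero) (max-tabulate-≤ (f ∘ fsuc) (f≤b ∘ fsuc))

-- Counting incidences

module _ {m} (G : Graph m) where

  adj⇒≢ : ∀ {v w} → adj G v w ≡ true → v ≢ w
  adj⇒≢ {v} vw refl with trans (sym vw) (adj-irr G v)
  ... | ()

  degree≡∑ : ∀ v → degree G v ≡ ∑[ w < m ] indicator (adj G v w)
  degree≡∑ v = sum-map-allFin (indicator ∘ adj G v)

  degree<m : ∀ v → degree G v < m
  degree<m v = begin-strict
    degree G v                       <⟨ m<m+n _ z<s ⟩
    degree G v + 1                   ≡⟨ cong₂ _+_ (degree≡∑ v) (sym (∑-δ v)) ⟩
    ∑[ w < m ] A w + ∑[ w < m ] D w  ≡⟨ ∑-distrib-+ A D ⟨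
    ∑[ w < m ] (A w + D w)           ≤⟨ ∑-mono-≤ adjacent-or-equal ⟩
    ∑[ w < m ] 1                     ≡⟨ trans (∑-const m 1) (*-identityʳ m) ⟩
    m                                ∎
    where
    open ≤-Reasoning
    A D : Fin m → ℕ
    A w = indicator (adj G v w)
    D w = indicator (does (v ≟ w))
    adjacent-or-equal : ∀ w → A w + D w ≤ 1
    adjacent-or-equal w with v ≟ w
    ... | yes refl rewrite adj-irr G v = ≤-refl
    ... | no _ with adj G v w
    ...   | true  = ≤-refl
    ...   | false = z≤n

  missing-< : ∀ {v w} → toℕ v < toℕ w → missing G v w ≡ (if adj G v w then 0 else 1)
  missing-< {v} {w} v<w with toℕ v ℕ.<? toℕ w
  ... | yes _   = refl
  ... | no v≮w = contradiction v<w v≮w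

  missing-≮ : ∀ {v w} → ¬ toℕ v < toℕ w → missing G v w ≡ 0
  missing-≮ {v} {w} v≮w with toℕ v ℕ.<? toℕ w
  ... | yes v<w = contradiction v<w v≮w
  ... | no _    = refl

  pair-partition : ∀ v w →
    indicator (adj G v w) + missing G v w + missing G w v + indicator (does (v ≟ w)) ≡ 1
  pair-partition v w with v ≟ w
  ... | yes refl rewrite missing-≮ (n≮n (toℕ v)) | adj-irr G v = refl
  ... | no v≢w with <-cmp (toℕ v) (toℕ w)
  ...   | tri≈ _ v≡w _ = contradiction (toℕ-injective v≡w) v≢w
  ...   | tri< v<w _ w≮v rewrite missing-< v<w | missing-≮ w≮v with adj G v w
  ...     | true  = refl
  ...     | false = refl
  pair-partition v w | no _ | tri> v≮w _ w<v rewrite missing-≮ v≮w | missing-< w<v | adj-sym G w v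
    with adj G v w
  ...     | true  = refl
  ...     | false = refl

  degreeSum : ℕ
  degreeSum = ∑[ v < m ] degree G v

  removedEdges≡∑∑ : removedEdges G ≡ ∑[ v < m ] ∑[ w < m ] missing G v w
  removedEdges≡∑∑ = trans (sum-map-allFin (λ v → List.sum (map (missing G v) (allFin m))))
                          (sum-cong-≗ (sum-map-allFin ∘ missing G))

  m*m≡degreeSum+2removedEdges+m : m * m ≡ degreeSum + 2 * removedEdges G + m
  m*m≡degreeSum+2removedEdges+m = begin
    m * m
      ≡⟨ ∑∑-one ⟨
    ∑∑ (λ _ _ → 1)
      ≡⟨ sum-cong-≗ (λ v → sum-cong-≗ (pair-partition v)) ⟨
    ∑∑ (λ v w → A v w + B v w + C v w + D v w)
      ≡⟨ ∑∑-distrib-+₄ ⟩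
    ∑∑ A + ∑∑ B + ∑∑ C + ∑∑ D
      ≡⟨ cong₂ _+_ (cong₂ _+_ (cong₂ _+_ ∑∑-adj (sym removedEdges≡∑∑)) ∑∑-missing-transposed)
                   ∑∑-diagonal ⟩
    degreeSum + r + r + m
      ≡⟨ cong (_+ m) (+-assoc degreeSum r r) ⟩
    degreeSum + (r + r) + m
      ≡⟨ cong (λ x → degreeSum + (r + x) + m) (+-identityʳ r) ⟨
    degreeSum + 2 * r + m
      ∎
    where
    open ≡-Reasoning
    r : ℕ
    r = removedEdges G
    ∑∑ : (Fin m → Fin m → ℕ) → ℕ
    ∑∑ f = ∑[ v < m ] ∑[ w < m ] f v w
    A B C D : Fin m → Fin m → ℕ
    A v w = indicator (adj G v w)
    B v w = missing G v w
    C v w = missing G w v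
    D v w = indicator (does (v ≟ w))
    ∑∑-distrib-+₄ : ∑∑ (λ v w → A v w + B v w + C v w + D v w) ≡
                    ∑∑ A + ∑∑ B + ∑∑ C + ∑∑ D
    ∑∑-distrib-+₄ = begin
      ∑∑ (λ v w → A v w + B v w + C v w + D v w)
        ≡⟨ ∑∑-distrib-+ (λ v w → A v w + B v w + C v w) D ⟩
      ∑∑ (λ v w → A v w + B v w + C v w) + ∑∑ D
        ≡⟨ cong (_+ ∑∑ D) (∑∑-distrib-+ (λ v w → A v w + B v w) C) ⟩
      ∑∑ (λ v w → A v w + B v w) + ∑∑ C + ∑∑ D
        ≡⟨ cong (λ x → x + ∑∑ C + ∑∑ D) (∑∑-distrib-+ A B) ⟩
      ∑∑ A + ∑∑ B + ∑∑ C + ∑∑ D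
        ∎
    ∑∑-one : ∑∑ (λ _ _ → 1) ≡ m * m
    ∑∑-one = trans (∑-const m (∑[ w < m ] 1)) (cong (m *_) (trans (∑-const m 1) (*-identityʳ m)))
    ∑∑-adj : ∑∑ A ≡ degreeSum
    ∑∑-adj = sum-cong-≗ (sym ∘ degree≡∑)
    ∑∑-missing-transposed : ∑∑ C ≡ r
    ∑∑-missing-transposed = trans (∑-comm {m} {m} (λ w v → missing G v w)) (sym removedEdges≡∑∑)
    ∑∑-diagonal : ∑∑ D ≡ m
    ∑∑-diagonal = trans (sum-cong-≗ {m} ∑-δ) (trans (∑-const m 1) (*-identityʳ m))

-- Colour classes of a conflict-free incidence colouring

ofColour : ∀ {k} (b : Bool) → (b ≡ true → Fin k) → Fin k → ℕ
ofColour true  f c = indicator (does (f refl ≟ c))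
ofColour false f c = 0

∑-ofColour : ∀ {k} b (f : b ≡ true → Fin k) → ∑[ c < k ] ofColour b f c ≡ indicator b
∑-ofColour     true  f = ∑-δ (f refl)
∑-ofColour {k} false f = sum-replicate-zero k

ofColour≤1 : ∀ {k} b (f : b ≡ true → Fin k) c → ofColour b f c ≤ 1
ofColour≤1 true f c with f refl ≟ c
... | yes _ = ≤-refl
... | no _  = z≤n
ofColour≤1 false f c = z≤n

ofColour-positive : ∀ {k} b (f : b ≡ true → Fin k) c → 0 < ofColour b f c →
                    Σ (b ≡ true) λ p → f p ≡ c
ofColour-positive true f c pos with f refl ≟ c
... | yes fc = refl , fc
... | no _   = contradiction pos (n≮n 0)

module _ {m k} (G : Graph m) (col : ConflictFreeIncidenceColouring G k) (cf : IsCFColouring G k col) where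

  hasColour : Fin k → Fin m → Fin m → ℕ
  hasColour c v w = ofColour (adj G v w) (col v w) c

  hasColour≤1 : ∀ c v w → hasColour c v w ≤ 1
  hasColour≤1 c v w = ofColour≤1 (adj G v w) (col v w) c

  hasColour-positive : ∀ {c v w} → 0 < hasColour c v w → Σ (adj G v w ≡ true) λ p → col v w p ≡ c
  hasColour-positive {c} {v} {w} = ofColour-positive (adj G v w) (col v w) c

  classSize : Fin k → ℕ
  classSize c = ∑[ v < m ] ∑[ w < m ] hasColour c v w

  ∑classSize≡degreeSum : ∑[ c < k ] classSize c ≡ degreeSum G
  ∑classSize≡degreeSum = begin
    ∑[ c < k ] ∑[ v < m ] ∑[ w < m ] hasColour c v w
      ≡⟨ ∑-comm (λ c v → ∑[ w < m ] hasColour c v w) ⟩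
    ∑[ v < m ] ∑[ c < k ] ∑[ w < m ] hasColour c v w
      ≡⟨ sum-cong-≗ (λ v → ∑-comm (λ c w → hasColour c v w)) ⟩
    ∑[ v < m ] ∑[ w < m ] ∑[ c < k ] hasColour c v w
      ≡⟨ sum-cong-≗ (λ v → sum-cong-≗ (λ w → ∑-ofColour (adj G v w) (col v w))) ⟩
    ∑[ v < m ] ∑[ w < m ] indicator (adj G v w)
      ≡⟨ sum-cong-≗ (sym ∘ degree≡∑ G) ⟩
    degreeSum G
      ∎
    where open ≡-Reasoning

  sameColour-conflict⇒≡ : ∀ {c v w v' w'} → 0 < hasColour c v w → 0 < hasColour c v' w' →
                          Conflict v w v' w' → (v , w) ≡ (v' , w')
  sameColour-conflict⇒≡ {v = v} {w} {v'} {w'} vw∈c v'w'∈c conflict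
    with hasColour-positive vw∈c | hasColour-positive v'w'∈c
  ... | p , vw↦c | p' , v'w'↦c = decidable-stable (≡-dec _≟_ _≟_ (v , w) (v' , w'))
                                   λ ne → cf v w v' w' p p' ne conflict (trans vw↦c (sym v'w'↦c))

  ∑-incidentAt≤1 : ∀ c z → ∑[ w < m ] (hasColour c z w + hasColour c w z) ≤ 1
  ∑-incidentAt≤1 c z = ∑-≤1 each≤1 unique
    where
    each≤1 : ∀ w → hasColour c z w + hasColour c w z ≤ 1
    each≤1 w = +-≤1 (hasColour≤1 c z w) (hasColour≤1 c w z) λ zw∈c wz∈c →
      adj⇒≢ G (proj₁ (hasColour-positive zw∈c))
        (cong proj₁ (sameColour-conflict⇒≡ zw∈c wz∈c (z , inj₁ refl , inj₂ refl)))
    unique : ∀ w w' → 0 < hasColour c z w + hasColour c w z → 0 < hasColour c z w' + hasColour c w' z →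
             w ≡ w'
    unique w w' pos pos' with +-positive (hasColour c z w) pos | +-positive (hasColour c z w') pos'
    ... | inj₁ zw∈c | inj₁ zw'∈c with sameColour-conflict⇒≡ zw∈c zw'∈c (z , inj₁ refl , inj₁ refl)
    ...   | refl = refl
    unique w w' _ _ | inj₁ zw∈c | inj₂ w'z∈c with sameColour-conflict⇒≡ zw∈c w'z∈c (z , inj₁ refl , inj₂ refl)
    ...   | refl = refl
    unique w w' _ _ | inj₂ wz∈c | inj₁ zw'∈c with sameColour-conflict⇒≡ wz∈c zw'∈c (z , inj₂ refl , inj₁ refl)
    ...   | refl = refl
    unique w w' _ _ | inj₂ wz∈c | inj₂ w'z∈c with sameColour-conflict⇒≡ wz∈c w'z∈c (z , inj₂ refl , inj₂ refl)
    ...   | refl = refl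

  classSize+classSize≤m : ∀ c → classSize c + classSize c ≤ m
  classSize+classSize≤m c = begin
    classSize c + classSize c
      ≡⟨ cong (classSize c +_) (∑-comm (hasColour c)) ⟩
    ∑[ z < m ] ∑[ w < m ] hasColour c z w + ∑[ z < m ] ∑[ w < m ] hasColour c w z
      ≡⟨ ∑∑-distrib-+ (hasColour c) (λ z w → hasColour c w z) ⟨
    ∑[ z < m ] ∑[ w < m ] (hasColour c z w + hasColour c w z)
      ≤⟨ ∑-mono-≤ (∑-incidentAt≤1 c) ⟩
    ∑[ z < m ] 1
      ≡⟨ trans (∑-const m 1) (*-identityʳ m) ⟩
    m ∎
    where open ≤-Reasoning

  classSize≤⌊m/2⌋ : ∀ c → classSize c ≤ ⌊ m /2⌋
  classSize≤⌊m/2⌋ c =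
    subst (_≤ ⌊ m /2⌋) (sym (n≡⌊n+n/2⌋ (classSize c))) (⌊n/2⌋-mono (classSize+classSize≤m c))

degreeSum≤colours*⌊m/2⌋ : ∀ {m k} (G : Graph m) → CFColourable G k → degreeSum G ≤ k * ⌊ m /2⌋
degreeSum≤colours*⌊m/2⌋ {m} {k} G (col , cf) = begin
  degreeSum G                      ≡⟨ ∑classSize≡degreeSum G col cf ⟨
  ∑[ c < k ] classSize G col cf c  ≤⟨ ∑-mono-≤ (classSize≤⌊m/2⌋ G col cf) ⟩
  ∑[ c < k ] ⌊ m /2⌋               ≡⟨ ∑-const k ⌊ m /2⌋ ⟩
  k * ⌊ m /2⌋                      ∎
  where open ≤-Reasoning

-- A conflict-free incidence colouring with 2m colours

m≤s<2m⇒s%m≡s∸m : ∀ {m s} .{{_ : NonZero m}} → m ≤ s → s < m + m → s % m ≡ s ∸ m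
m≤s<2m⇒s%m≡s∸m {m} {s} m≤s s<2m =
  trans (sym (m≤n⇒[n∸m]%m≡n%m m≤s)) (m<n⇒m%n≡m (m<n+o⇒m∸n<o s m s<2m))

+-∸-no-wraparound : ∀ {m z a b} → b < m → m ≤ z + b → z + a ≢ z + b ∸ m
+-∸-no-wraparound {m} {z} {a} {b} b<m m≤z+b eq = <-irrefl refl (begin-strict
  z + b          <⟨ +-monoʳ-< z b<m ⟩
  z + m          ≤⟨ +-monoˡ-≤ m (m≤m+n z a) ⟩
  z + a + m      ≡⟨ cong (_+ m) eq ⟩
  z + b ∸ m + m  ≡⟨ m∸n+n≡m m≤z+b ⟩
  z + b          ∎)
  where open ≤-Reasoning

+-%-cancelˡ : ∀ {m z x y} .{{_ : NonZero m}} → z < m → x < m → y < m →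
              (z + x) % m ≡ (z + y) % m → x ≡ y
+-%-cancelˡ {m} {z} {x} {y} z<m x<m y<m eq with z + x ℕ.<? m | z + y ℕ.<? m
... | yes zx<m | yes zy<m = +-cancelˡ-≡ z x y (begin
  z + x        ≡⟨ m<n⇒m%n≡m zx<m ⟨
  (z + x) % m  ≡⟨ eq ⟩
  (z + y) % m  ≡⟨ m<n⇒m%n≡m zy<m ⟩
  z + y        ∎)
  where open ≡-Reasoning
... | no zx≮m  | no zy≮m  = +-cancelˡ-≡ z x y (∸-cancelʳ-≡ (≮⇒≥ zx≮m) (≮⇒≥ zy≮m) (begin
  z + x ∸ m    ≡⟨ m≤s<2m⇒s%m≡s∸m (≮⇒≥ zx≮m) (+-mono-< z<m x<m) ⟨
  (z + x) % m  ≡⟨ eq ⟩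
  (z + y) % m  ≡⟨ m≤s<2m⇒s%m≡s∸m (≮⇒≥ zy≮m) (+-mono-< z<m y<m) ⟩
  z + y ∸ m    ∎))
  where open ≡-Reasoning
... | yes zx<m | no zy≮m  = ⊥-elim (+-∸-no-wraparound y<m (≮⇒≥ zy≮m)
  (trans (sym (m<n⇒m%n≡m zx<m)) (trans eq (m≤s<2m⇒s%m≡s∸m (≮⇒≥ zy≮m) (+-mono-< z<m y<m)))))
... | no zx≮m  | yes zy<m = ⊥-elim (+-∸-no-wraparound x<m (≮⇒≥ zx≮m)
  (trans (sym (m<n⇒m%n≡m zy<m)) (trans (sym eq) (m≤s<2m⇒s%m≡s∸m (≮⇒≥ zx≮m) (+-mono-< z<m x<m)))))

module _ {m} .{{_ : NonZero m}} where

  _⊕_ : Fin m → Fin m → Fin m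
  v ⊕ w = (toℕ v + toℕ w) mod m

  ⊕-comm : ∀ v w → v ⊕ w ≡ w ⊕ v
  ⊕-comm v w = cong (_mod m) (+-comm (toℕ v) (toℕ w))

  ⊕-cancelˡ : ∀ z {x y} → z ⊕ x ≡ z ⊕ y → x ≡ y
  ⊕-cancelˡ z {x} {y} eq = toℕ-injective (+-%-cancelˡ (toℕ<n z) (toℕ<n x) (toℕ<n y)
    (trans (sym (toℕ-fromℕ< _)) (trans (cong toℕ eq) (toℕ-fromℕ< _))))

combine-injective : ∀ {a b} {i i' : Fin a} {j j' : Fin b} → combine i j ≡ combine i' j' → i ≡ i' × j ≡ j'
combine-injective {b = b} {i} {i'} {j} {j'} eq =
  ,-injective (trans (sym (remQuot-combine i j)) (trans (cong (remQuot b) eq) (remQuot-combine i' j')))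

orientation : ∀ {m} → Fin m → Fin m → Fin 2
orientation v w with v Fin.<? w
... | yes _ = fzero
... | no _  = fsuc fzero

orientation-flip : ∀ {m} {v w : Fin m} → v ≢ w → orientation v w ≢ orientation w v
orientation-flip {v = v} {w} v≢w with v Fin.<? w | w Fin.<? v
... | yes v<w | yes w<v = λ _ → Fin.<-asym v<w w<v
... | yes _   | no _    = λ ()
... | no _    | yes _   = λ ()
... | no v≮w  | no w≮v with Fin.<-cmp v w
...   | tri< v<w _ _ = λ _ → v≮w v<w
...   | tri≈ _ v≡w _ = λ _ → v≢w v≡w
...   | tri> _ _ w<v = λ _ → w≮v w<v

module _ {m} .{{_ : NonZero m}} (G : Graph m) where

  latinColouring : ConflictFreeIncidenceColouring G (2 * m)
  latinColouring v w _ = combine (orientation v w) (v ⊕ w)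

  latinColouring-isCF : IsCFColouring G (2 * m) latinColouring
  latinColouring-isCF v w v' w' p p' ne (z , z∈vw , z∈v'w') same
    with combine-injective {i = orientation v w} {orientation v' w'} same
  latinColouring-isCF v w v' w' p p' ne (z , inj₁ refl , inj₁ refl) _ | _ , v⊕w≡v⊕w'
    with ⊕-cancelˡ v v⊕w≡v⊕w'
  ... | refl = ne refl
  latinColouring-isCF v w v' w' p p' ne (z , inj₁ refl , inj₂ refl) _ | same-orientation , v⊕w≡v'⊕v
    with ⊕-cancelˡ v (trans v⊕w≡v'⊕v (⊕-comm v' v))
  ... | refl = orientation-flip (adj⇒≢ G p) same-orientation
  latinColouring-isCF v w v' w' p p' ne (z , inj₂ refl , inj₁ refl) _ | same-orientation , v⊕w≡w⊕w'
    with ⊕-cancelˡ w (trans (⊕-comm w v) v⊕w≡w⊕w')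
  ... | refl = orientation-flip (adj⇒≢ G p) same-orientation
  latinColouring-isCF v w v' w' p p' ne (z , inj₂ refl , inj₂ refl) _ | _ , v⊕w≡v'⊕w
    with ⊕-cancelˡ w (trans (⊕-comm w v) (trans v⊕w≡v'⊕w (⊕-comm v' w)))
  ... | refl = ne refl

  2m-colourable : CFColourable G (2 * m)
  2m-colourable = latinColouring , latinColouring-isCF

⌊2n+1/2⌋≡n : ∀ n → ⌊ 2 * n + 1 /2⌋ ≡ n
⌊2n+1/2⌋≡n zero    = refl
⌊2n+1/2⌋≡n (suc n) = trans (cong ⌊_/2⌋ (2[1+n]+1≡2+[2n+1] n)) (cong suc (⌊2n+1/2⌋≡n n))
  where
  2[1+n]+1≡2+[2n+1] : ∀ n → 2 * suc n + 1 ≡ suc (suc (2 * n + 1))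
  2[1+n]+1≡2+[2n+1] = solve-∀

module _ (n : ℕ) (G : Graph (2 * n + 1)) (few-removed : 2 * removedEdges G < n) where

  [2n+1]2n<degreeSum+n : (2 * n + 1) * (2 * n) < degreeSum G + n
  [2n+1]2n<degreeSum+n = begin-strict
    (2 * n + 1) * (2 * n)             ≤⟨ +-cancelʳ-≤ (2 * n + 1) _ _ (≤-reflexive count) ⟩
    degreeSum G + 2 * removedEdges G  <⟨ +-monoʳ-< (degreeSum G) few-removed ⟩
    degreeSum G + n                   ∎
    where
    open ≤-Reasoning
    count : (2 * n + 1) * (2 * n) + (2 * n + 1) ≡ degreeSum G + 2 * removedEdges G + (2 * n + 1)
    count = begin-equality
      (2 * n + 1) * (2 * n) + (2 * n + 1)             ≡⟨ cong ((2 * n + 1) * (2 * n) +_) (*-identityʳ _) ⟨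
      (2 * n + 1) * (2 * n) + (2 * n + 1) * 1         ≡⟨ *-distribˡ-+ (2 * n + 1) (2 * n) 1 ⟨
      (2 * n + 1) * (2 * n + 1)                       ≡⟨ m*m≡degreeSum+2removedEdges+m G ⟩
      degreeSum G + 2 * removedEdges G + (2 * n + 1)  ∎

  maxDegree≡2n : maxDegree G ≡ 2 * n
  maxDegree≡2n = ≤-antisym (maximum-≤ (degree G) degree≤2n) (≮⇒≥ Δ≮2n)
    where
    degree≤2n : ∀ v → degree G v ≤ 2 * n
    degree≤2n v = m<1+n⇒m≤n (subst (degree G v <_) (+-comm (2 * n) 1) (degree<m G v))
    Δ≮2n : ¬ maxDegree G < 2 * n
    Δ≮2n Δ<2n = <⇒≱ [2n+1]2n<degreeSum+n (begin
      degreeSum G + n                     ≤⟨ +-mono-≤ (∑-mono-≤ (≤-maximum (degree G))) n≤2n+1 ⟩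
      ∑[ v < 2 * n + 1 ] Δ + (2 * n + 1)  ≡⟨ cong (_+ (2 * n + 1)) (∑-const (2 * n + 1) Δ) ⟩
      (2 * n + 1) * Δ + (2 * n + 1)       ≡⟨ trans (*-suc (2 * n + 1) Δ) (+-comm (2 * n + 1) _) ⟨
      (2 * n + 1) * suc Δ                 ≤⟨ *-monoʳ-≤ (2 * n + 1) Δ<2n ⟩
      (2 * n + 1) * (2 * n)               ∎)
      where
      open ≤-Reasoning
      Δ : ℕ
      Δ = maxDegree G
      n≤2n+1 : n ≤ 2 * n + 1
      n≤2n+1 = ≤-trans (m≤m+n n (n + 0)) (m≤m+n (2 * n) 1)

  4n+2≤colours : ∀ j → CFColourable G j → 2 * (2 * n) + 2 ≤ j
  4n+2≤colours j colourable = ≮⇒≥ λ j<4n+2 → <⇒≱ [2n+1]2n<degreeSum+n (begin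
    degreeSum G + n          ≤⟨ +-monoˡ-≤ n (degreeSum≤colours*⌊m/2⌋ G colourable) ⟩
    j * ⌊ 2 * n + 1 /2⌋ + n  ≡⟨ cong (λ h → j * h + n) (⌊2n+1/2⌋≡n n) ⟩
    j * n + n                ≡⟨ +-comm (j * n) n ⟩
    suc j * n                ≤⟨ *-monoˡ-≤ n j<4n+2 ⟩
    (2 * (2 * n) + 2) * n    ≡⟨ [4n+2]n≡[2n+1]2n n ⟩
    (2 * n + 1) * (2 * n)    ∎)
    where
    open ≤-Reasoning
    [4n+2]n≡[2n+1]2n : ∀ n → (2 * (2 * n) + 2) * n ≡ (2 * n + 1) * (2 * n)
    [4n+2]n≡[2n+1]2n = solve-∀

  4n+2-colourable : CFColourable G (2 * (2 * n) + 2)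
  4n+2-colourable = subst (CFColourable G) (*-distribˡ-+ 2 (2 * n) 1) (2m-colourable {{2n+1≢0}} G)
    where
    2n+1≢0 : NonZero (2 * n + 1)
    2n+1≢0 = >-nonZero (m≤n+m 1 (2 * n))

proposition2p7 : (n : ℕ) → 1 ≤ n → (G : Graph (2 * n + 1)) →
    2 * removedEdges G < n →
    IncidenceCFChromatic G (2 * maxDegree G + 2) × (2 * maxDegree G + 2 ≡ 4 * n + 2)
proposition2p7 n _ G few-removed rewrite maxDegree≡2n n G few-removed =
  (4n+2-colourable n G few-removed , 4n+2≤colours n G few-removed) , cong (_+ 2) (sym (*-assoc 2 2 n))
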